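{- Let $\mathcal{X}_n$ be the number of children of the root that are leaves, in a strongly increasing Schröder tree chosen uniformly at random among all strongly increasing Schröder trees with $n$ leaves. Then, as $n\to\infty$, \[ \mathbb{E}(\mathcal{X}_n)=\frac{2e}{n}+O\!\left(\frac{1}{n!}\right)\qquad\text{and}\qquad \mathbb{V}(\mathcal{X}_n)=\frac{2e}{n}+O\!\left(\frac{1}{n^2}\right). \]
   Context: A Schröder tree is a rooted plane tree (children of each node are ordered) in which every internal node has at least two children; its size is its number of leaves. A strongly increasing Schröder tree is a Schröder tree whose internal nodes carry labels such that, if there are $\ell$ internal nodes, the labels are exactly $1,\dots,\ell$, each used once, and labels strictly increase along every path from the root to a leaf. Leaves are unlabeled. -}

module Defs where

open import Data.Nat as ℕ using (ℕ; zero; suc; _≤_)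
open import Data.Nat using (_!)
open import Data.Integer using (+_)
open import Data.Rational as ℚ using (ℚ; _/_; _+_; _*_; _-_; ∣_∣)
open import Data.List using (List; []; _∷_; map; upTo; length)
open import Data.Nat.ListAction using (sum)
open import Data.List.Relation.Binary.Permutation.Propositional using (_↭_)
open import Data.List.Relation.Unary.Unique.Propositional using (Unique)
open import Data.List.Membership.Propositional using (_∈_)
open import Data.Product using (_×_)
open import Data.Unit using (⊤)
open import Relation.Binary.PropositionalEquality using (_≡_)
open import Function.Bundles using (_⇔_)

data Tree : Set where
  leaf : Tree
  node : ℕ → List Tree → Tree

mutual
  leaves : Tree → ℕ
  leaves leaf        = 1
  leaves (node _ cs) = leavesF cs

  leavesF : List Tree → ℕ
  leavesF []       = 0
  leavesF (c ∷ cs) = leaves c ℕ.+ leavesF cs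

mutual
  labels : Tree → List ℕ
  labels leaf        = []
  labels (node l cs) = l ∷ labelsF cs

  labelsF : List Tree → List ℕ
  labelsF []       = []
  labelsF (c ∷ cs) = labels c Data.List.++ labelsF cs

internals : Tree → ℕ
internals t = length (labels t)

mutual
  IsSchroeder : Tree → Set
  IsSchroeder leaf        = ⊤
  IsSchroeder (node _ cs) = (2 ≤ length cs) × AllSchroeder cs

  AllSchroeder : List Tree → Set
  AllSchroeder []       = ⊤
  AllSchroeder (c ∷ cs) = IsSchroeder c × AllSchroeder cs

AboveLabel : ℕ → Tree → Set
AboveLabel p leaf       = ⊤
AboveLabel p (node l _) = p ℕ.< l

mutual
  Increasing : Tree → Set
  Increasing leaf        = ⊤
  Increasing (node l cs) = AllIncr l cs

  AllIncr : ℕ → List Tree → Set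
  AllIncr p []       = ⊤
  AllIncr p (c ∷ cs) = AboveLabel p c × Increasing c × AllIncr p cs

IsSIST : Tree → Set
IsSIST t = IsSchroeder t
         × (labels t ↭ map suc (upTo (internals t)))
         × Increasing t

Enumerates : ℕ → List Tree → Set
Enumerates n L = Unique L × (∀ t → (t ∈ L) ⇔ (IsSIST t × leaves t ≡ n))

leafChildrenF : List Tree → ℕ
leafChildrenF []             = 0
leafChildrenF (leaf ∷ cs)    = suc (leafChildrenF cs)
leafChildrenF (node _ _ ∷ cs) = leafChildrenF cs

X : Tree → ℕ
X leaf        = 0
X (node _ cs) = leafChildrenF cs

-- 1/k as a rational (with the junk value 0 for k = 0; only used for k > 0)
inv : ℕ → ℚ
inv zero    = ℚ.0ℚ
inv (suc k) = + 1 / suc k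

fromℕ : ℕ → ℚ
fromℕ k = + k / 1

mean : List Tree → (Tree → ℕ) → ℚ
mean L f = fromℕ (sum (map f L)) * inv (length L)

expect : List Tree → ℚ
expect L = mean L X

variance : List Tree → ℚ
variance L = mean L (λ t → X t ℕ.* X t) - expect L * expect L

eApprox : ℕ → ℚ
eApprox zero    = ℚ.1ℚ
eApprox (suc m) = eApprox m + inv (suc m !)

-- |x - a·e| ≤ b, for a ≥ 0, expressed with rationals only.
-- Since 0 ≤ e - eApprox m ≤ 2/(m+1)! → 0, for a ≥ 0 this is
-- equivalent to the real inequality |x - a·e| ≤ b.
CloseToMultipleOfE : ℚ → ℚ → ℚ → Set
CloseToMultipleOfE x a b =
  ∀ m → ∣ x - a * eApprox m ∣ ℚ.≤ b + a * (fromℕ 2 * inv (suc m !))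

module Submission where

-- In a SIST with n ≥ 2 leaves the node carrying the largest
-- label ℓ+1 has only leaf children, say n-m+1 ≥ 2 of them; replacing it by a
-- leaf gives a SIST with m < n leaves.  Conversely, grafting such a "star" on
-- any of the m leaves of a SIST with m leaves gives a SIST with n leaves, and
-- the two operations are mutually inverse.  This yields an explicit
-- duplicate-free list 'sists n' of all SISTs with n leaves, of which every
-- enumerating list is a permutation.  Grafting on a leaf child of the root
-- lowers X by one and grafting elsewhere keeps X; hence for h(x) = 1, x and
-- x(x-1) the sums Fₕ(n) = Σₜ h(X t) satisfy linear recurrences in n, solved
-- in closed form: Σ 1 = n!/2, Σ X = (n-1)!·e_{n-1} with e_j = Σ_{i≤j} 1/i!,
-- and Σ X(X-1) = dₙ for an explicit sequence d.
--
-- Consequently E(Xₙ) = (2/n)·e_{n-1} exactly, within 4/(n·n!) of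
-- 2e/n (e being represented by its partial sums), while
-- V(Xₙ) = E(Xₙ) + (E(X(X-1)) - E(Xₙ)²) with both bracketed terms O(1/n²) by
-- elementary bounds on the closed forms.

open import Defs

module Counting where
  open import Data.Nat using (ℕ; _≤_; _!; zero; suc; _+_; _*_; _∸_; _<_; z≤n; s≤s; _≟_)
  import Data.Nat.Properties as NP
  open import Data.Nat.Tactic.RingSolver using (solve-∀)
  open import Data.Nat.ListAction using (sum)
  import Data.Nat.ListAction.Properties as SumP
  open import Data.List using (List; []; _∷_; _++_; map; replicate; length; upTo; applyUpTo; concatMap; _∷ʳ_)
  import Data.List.Properties as LP
  open import Data.List.Membership.Propositional using (_∈_; _∉_; find; lose)
  open import Data.List.Membership.Propositional.Properties
    using (∈-map⁺; ∈-map⁻; ∈-++⁺ˡ; ∈-++⁺ʳ; ∈-++⁻; ∈-concatMap⁺; ∈-concatMap⁻; ∈-upTo⁺; ∈-upTo⁻)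
  open import Data.List.Membership.Propositional.Properties.WithK using (unique∧set⇒bag)
  open import Data.List.Relation.Unary.Any using (here; there)
  open import Data.List.Relation.Unary.All as All using (All; []; _∷_)
  import Data.List.Relation.Unary.All.Properties as AllP
  open import Data.List.Relation.Unary.AllPairs using (AllPairs)
  open import Data.List.Relation.Unary.Unique.Propositional using (Unique)
  import Data.List.Relation.Unary.Unique.Propositional.Properties as UniqueP
  open import Data.List.Relation.Binary.Permutation.Propositional
    using (_↭_; prep; ↭-sym; ↭-trans; ↭-refl; module PermutationReasoning)
  import Data.List.Relation.Binary.Permutation.Propositional.Properties as PermP
  open import Data.List.Relation.Binary.BagAndSetEquality using (∼bag⇒↭)
  open import Data.Product using (Σ; _×_; _,_; proj₁; proj₂)
  open import Data.Sum using (inj₁; inj₂)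
  open import Data.Unit using (tt)
  open import Data.Empty using (⊥-elim)
  open import Function.Bundles using (_⇔_; mk⇔; Equivalence)
  open import Relation.Nullary using (¬_; yes; no)
  open import Relation.Binary.PropositionalEquality

  total : {A : Set} → (A → ℕ) → List A → ℕ
  total f xs = sum (map f xs)

  total-++ : {A : Set} (f : A → ℕ) (xs ys : List A) → total f (xs ++ ys) ≡ total f xs + total f ys
  total-++ f xs ys = trans (cong sum (LP.map-++ f xs ys)) (SumP.sum-++ (map f xs) (map f ys))

  total-map : {A B : Set} (f : B → ℕ) (g : A → B) (xs : List A) → total f (map g xs) ≡ total (λ x → f (g x)) xs
  total-map f g xs = cong sum (sym (LP.map-∘ xs))

  total-↭ : {A : Set} (f : A → ℕ) {xs ys : List A} → xs ↭ ys → total f xs ≡ total f ys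
  total-↭ f p = SumP.sum-↭ (PermP.map⁺ f p)

  total-cong : {A : Set} {f g : A → ℕ} (xs : List A) → (∀ x → x ∈ xs → f x ≡ g x) → total f xs ≡ total g xs
  total-cong [] eq = refl
  total-cong (x ∷ xs) eq = cong₂ _+_ (eq x (here refl)) (total-cong xs (λ y y∈ → eq y (there y∈)))

  total-const : {A : Set} (f : A → ℕ) (xs : List A) (a : ℕ) → (∀ x → x ∈ xs → f x ≡ a) → total f xs ≡ length xs * a
  total-const f [] a eq = refl
  total-const f (x ∷ xs) a eq = cong₂ _+_ (eq x (here refl)) (total-const f xs a (λ y y∈ → eq y (there y∈)))

  total-+ : {A : Set} (f g : A → ℕ) (xs : List A) → total (λ x → f x + g x) xs ≡ total f xs + total g xs
  total-+ f g [] = refl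
  total-+ f g (x ∷ xs) = trans (cong (f x + g x +_) (total-+ f g xs)) (interchange (f x) (g x) (total f xs) (total g xs))
    where
    interchange : ∀ a b c d → a + b + (c + d) ≡ a + c + (b + d)
    interchange = solve-∀

  total-*ˡ : {A : Set} (a : ℕ) (f : A → ℕ) (xs : List A) → total (λ x → a * f x) xs ≡ a * total f xs
  total-*ˡ a f [] = sym (NP.*-zeroʳ a)
  total-*ˡ a f (x ∷ xs) = trans (cong (a * f x +_) (total-*ˡ a f xs)) (sym (NP.*-distribˡ-+ a (f x) (total f xs)))

  total-concatMap : {A B : Set} (h : B → ℕ) (f : A → List B) (xs : List A) →
                    total h (concatMap f xs) ≡ total (λ x → total h (f x)) xs
  total-concatMap h f [] = refl
  total-concatMap h f (x ∷ xs) = trans (total-++ h (f x) (concatMap f xs)) (cong (total h (f x) +_) (total-concatMap h f xs))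

  total-upTo-suc : (g : ℕ → ℕ) (k : ℕ) → total g (upTo (suc k)) ≡ total g (upTo k) + g k
  total-upTo-suc g k = trans (cong (total g) (sym (LP.upTo-∷ʳ k)))
                         (trans (total-++ g (upTo k) (k ∷ [])) (cong (total g (upTo k) +_) (NP.+-identityʳ (g k))))

  concatMap-unique : {A B : Set} (f : A → List B) (xs : List A) → Unique xs → (∀ x → x ∈ xs → Unique (f x)) →
                     (g : B → A) → (∀ x v → x ∈ xs → v ∈ f x → g v ≡ x) → Unique (concatMap f xs)
  concatMap-unique f [] _ _ _ _ = AllPairs.[]
  concatMap-unique f (x ∷ xs) (x∉xs AllPairs.∷ uxs) uf g eg =
    UniqueP.++⁺ (uf x (here refl)) (concatMap-unique f xs uxs (λ y y∈ → uf y (there y∈)) g (λ y v y∈ → eg y v (there y∈))) disjoint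
    where
    disjoint : ∀ {v} → ¬ (v ∈ f x × v ∈ concatMap f xs)
    disjoint {v} (v∈fx , v∈rest) with find (∈-concatMap⁻ f {xs = xs} v∈rest)
    ... | y , y∈xs , v∈fy = All.lookup x∉xs y∈xs (trans (sym (eg x v (here refl) v∈fx)) (eg y v (there y∈xs) v∈fy))

  same-members-↭ : {A : Set} {xs ys : List A} (P : A → Set) → Unique xs → Unique ys →
                   (∀ t → t ∈ xs ⇔ P t) → (∀ t → t ∈ ys ⇔ P t) → xs ↭ ys
  same-members-↭ P uxs uys exs eys = ∼bag⇒↭ (unique∧set⇒bag uxs uys (λ {t} →
    mk⇔ (λ m → Equivalence.from (eys t) (Equivalence.to (exs t) m)) (λ m → Equivalence.from (exs t) (Equivalence.to (eys t) m))))

  mutual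
    graft : Tree → Tree → List Tree
    graft s leaf        = s ∷ []
    graft s (node l cs) = map (node l) (graftF s cs)

    graftF : Tree → List Tree → List (List Tree)
    graftF s []       = []
    graftF s (c ∷ cs) = map (_∷ cs) (graft s c) ++ map (c ∷_) (graftF s cs)

  data GraftedIn (s : Tree) : List Tree → List Tree → Set where
    inHead : ∀ {c u cs} → u ∈ graft s c → GraftedIn s (c ∷ cs) (u ∷ cs)
    inTail : ∀ {c cs cs'} → cs' ∈ graftF s cs → GraftedIn s (c ∷ cs) (c ∷ cs')

  graftF-inv : ∀ s c cs {v} → v ∈ graftF s (c ∷ cs) → GraftedIn s (c ∷ cs) v
  graftF-inv s c cs v∈ with ∈-++⁻ (map (_∷ cs) (graft s c)) v∈
  ... | inj₁ v∈hd with ∈-map⁻ (_∷ cs) v∈hd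
  ...   | u , u∈ , refl = inHead u∈
  graftF-inv s c cs v∈ | inj₂ v∈tl with ∈-map⁻ (c ∷_) v∈tl
  ...   | cs' , cs'∈ , refl = inTail cs'∈

  graft-node-inv : ∀ {s l cs u} → u ∈ graft s (node l cs) → Σ (List Tree) λ cs' → cs' ∈ graftF s cs × u ≡ node l cs'
  graft-node-inv {l = l} u∈ = ∈-map⁻ (node l) u∈

  graftF-head : ∀ {s c u} cs → u ∈ graft s c → (u ∷ cs) ∈ graftF s (c ∷ cs)
  graftF-head cs u∈ = ∈-++⁺ˡ (∈-map⁺ (_∷ cs) u∈)

  graftF-tail : ∀ {s c cs cs'} → cs' ∈ graftF s cs → (c ∷ cs') ∈ graftF s (c ∷ cs)
  graftF-tail {s} {c} {cs} cs'∈ = ∈-++⁺ʳ (map (_∷ cs) (graft s c)) (∈-map⁺ (c ∷_) cs'∈)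

  graft-node : ∀ {s l cs cs'} → cs' ∈ graftF s cs → node l cs' ∈ graft s (node l cs)
  graft-node = ∈-map⁺ (node _)

  mutual
    length-graft : ∀ s t → length (graft s t) ≡ leaves t
    length-graft s leaf        = refl
    length-graft s (node l cs) = trans (LP.length-map (node l) (graftF s cs)) (length-graftF s cs)

    length-graftF : ∀ s cs → length (graftF s cs) ≡ leavesF cs
    length-graftF s [] = refl
    length-graftF s (c ∷ cs) = begin
      length (map (_∷ cs) (graft s c) ++ map (c ∷_) (graftF s cs))
        ≡⟨ LP.length-++ (map (_∷ cs) (graft s c)) ⟩
      length (map (_∷ cs) (graft s c)) + length (map (c ∷_) (graftF s cs))
        ≡⟨ cong₂ _+_ (LP.length-map (_∷ cs) (graft s c)) (LP.length-map (c ∷_) (graftF s cs)) ⟩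
      length (graft s c) + length (graftF s cs)
        ≡⟨ cong₂ _+_ (length-graft s c) (length-graftF s cs) ⟩
      leaves c + leavesF cs ∎
      where open ≡-Reasoning

  +1-to-front : ∀ a b → a + b + 1 ≡ a + 1 + b
  +1-to-front = solve-∀

  +-exchange : ∀ a b c → a + (b + c) ≡ b + (a + c)
  +-exchange = solve-∀

  mutual
    leaves-graft : ∀ s t {u} → u ∈ graft s t → leaves u + 1 ≡ leaves s + leaves t
    leaves-graft s leaf (here refl) = refl
    leaves-graft s (node l cs) u∈ with graft-node-inv {s = s} {cs = cs} u∈
    ... | cs' , cs'∈ , refl = leaves-graftF s cs cs'∈

    leaves-graftF : ∀ s cs {v} → v ∈ graftF s cs → leavesF v + 1 ≡ leaves s + leavesF cs
    leaves-graftF s (c ∷ cs) v∈ with graftF-inv s c cs v∈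
    ... | inHead {u = u} u∈ =
      trans (+1-to-front (leaves u) (leavesF cs)) (trans (cong (_+ leavesF cs) (leaves-graft s c u∈)) (NP.+-assoc (leaves s) _ _))
    ... | inTail {cs' = cs'} cs'∈ =
      trans (NP.+-assoc (leaves c) _ 1) (trans (cong (leaves c +_) (leaves-graftF s cs cs'∈)) (+-exchange (leaves c) (leaves s) (leavesF cs)))

  mutual
    labels-graft : ∀ s t {u} → u ∈ graft s t → labels u ↭ labels s ++ labels t
    labels-graft s leaf (here refl) = ↭-sym (PermP.++-identityʳ (labels s))
    labels-graft s (node l cs) u∈ with graft-node-inv {s = s} {cs = cs} u∈
    ... | cs' , cs'∈ , refl = ↭-trans (prep l (labels-graftF s cs cs'∈)) (↭-sym (PermP.shift l (labels s) (labelsF cs)))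

    labels-graftF : ∀ s cs {v} → v ∈ graftF s cs → labelsF v ↭ labels s ++ labelsF cs
    labels-graftF s (c ∷ cs) v∈ with graftF-inv s c cs v∈
    ... | inHead u∈ = ↭-trans (PermP.++⁺ʳ (labelsF cs) (labels-graft s c u∈)) (PermP.++-assoc (labels s) (labels c) (labelsF cs))
    ... | inTail cs'∈ = ↭-trans (PermP.++⁺ˡ (labels c) (labels-graftF s cs cs'∈)) (PermP.shifts (labels c) (labels s))

  internals-graft : ∀ s t {u} → u ∈ graft s t → internals u ≡ internals s + internals t
  internals-graft s t u∈ = trans (PermP.↭-length (labels-graft s t u∈)) (LP.length-++ (labels s))

  length-graftF-member : ∀ s cs {v} → v ∈ graftF s cs → length v ≡ length cs
  length-graftF-member s (c ∷ cs) v∈ with graftF-inv s c cs v∈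
  ... | inHead _    = refl
  ... | inTail cs'∈ = cong suc (length-graftF-member s cs cs'∈)

  mutual
    schroeder-graft : ∀ s t {u} → u ∈ graft s t → IsSchroeder s → IsSchroeder t → IsSchroeder u
    schroeder-graft s leaf (here refl) ss _ = ss
    schroeder-graft s (node l cs) u∈ ss (two , scs) with graft-node-inv {s = s} {cs = cs} u∈
    ... | cs' , cs'∈ , refl = subst (2 ≤_) (sym (length-graftF-member s cs cs'∈)) two , schroeder-graftF s cs cs'∈ ss scs

    schroeder-graftF : ∀ s cs {v} → v ∈ graftF s cs → IsSchroeder s → AllSchroeder cs → AllSchroeder v
    schroeder-graftF s (c ∷ cs) v∈ ss (sc , scs) with graftF-inv s c cs v∈
    ... | inHead u∈   = schroeder-graft s c u∈ ss sc , scs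
    ... | inTail cs'∈ = sc , schroeder-graftF s cs cs'∈ ss scs

  mutual
    schroeder-ungraft : ∀ s t {u} → u ∈ graft s t → IsSchroeder u → IsSchroeder t × IsSchroeder s
    schroeder-ungraft s leaf (here refl) su = tt , su
    schroeder-ungraft s (node l cs) u∈ su with graft-node-inv {s = s} {cs = cs} u∈
    schroeder-ungraft s (node l cs) u∈ (two , sv) | cs' , cs'∈ , refl with schroeder-ungraftF s cs cs'∈ sv
    ... | scs , ss = (subst (2 ≤_) (length-graftF-member s cs cs'∈) two , scs) , ss

    schroeder-ungraftF : ∀ s cs {v} → v ∈ graftF s cs → AllSchroeder v → AllSchroeder cs × IsSchroeder s
    schroeder-ungraftF s (c ∷ cs) v∈ sv with graftF-inv s c cs v∈
    schroeder-ungraftF s (c ∷ cs) v∈ (su , scs) | inHead u∈ with schroeder-ungraft s c u∈ su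
    ... | sc , ss = (sc , scs) , ss
    schroeder-ungraftF s (c ∷ cs) v∈ (sc , sv) | inTail cs'∈ with schroeder-ungraftF s cs cs'∈ sv
    ... | scs , ss = (sc , scs) , ss

  above-graft : ∀ {s p} c {u} → u ∈ graft s c → AboveLabel p s → AboveLabel p c → AboveLabel p u
  above-graft leaf (here refl) as _ = as
  above-graft {s} (node l cs) u∈ _ ac with graft-node-inv {s = s} {cs = cs} u∈
  ... | _ , _ , refl = ac

  above-ungraft : ∀ {s p} c {u} → u ∈ graft s c → AboveLabel p u → AboveLabel p c
  above-ungraft leaf _ _ = tt
  above-ungraft {s} (node l cs) u∈ au with graft-node-inv {s = s} {cs = cs} u∈
  ... | _ , _ , refl = au

  mutual
    increasing-graft : ∀ s t {u} → u ∈ graft s t → Increasing s → Increasing t →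
                       All (λ x → AboveLabel x s) (labels t) → Increasing u
    increasing-graft s leaf (here refl) is _ _ = is
    increasing-graft s (node l cs) u∈ is it (al ∷ ab) with graft-node-inv {s = s} {cs = cs} u∈
    ... | cs' , cs'∈ , refl = increasing-graftF s l cs cs'∈ is it al ab

    increasing-graftF : ∀ s p cs {v} → v ∈ graftF s cs → Increasing s → AllIncr p cs → AboveLabel p s →
                        All (λ x → AboveLabel x s) (labelsF cs) → AllIncr p v
    increasing-graftF s p (c ∷ cs) v∈ is (ac , ic , ics) al ab with graftF-inv s c cs v∈
    ... | inHead u∈ = above-graft c u∈ al ac , increasing-graft s c u∈ is ic (AllP.++⁻ˡ (labels c) ab) , ics
    ... | inTail cs'∈ = ac , ic , increasing-graftF s p cs cs'∈ is ics al (AllP.++⁻ʳ (labels c) ab)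

  mutual
    increasing-ungraft : ∀ s t {u} → u ∈ graft s t → Increasing u → Increasing t
    increasing-ungraft s leaf _ _ = tt
    increasing-ungraft s (node l cs) u∈ iu with graft-node-inv {s = s} {cs = cs} u∈
    ... | cs' , cs'∈ , refl = increasing-ungraftF s l cs cs'∈ iu

    increasing-ungraftF : ∀ s p cs {v} → v ∈ graftF s cs → AllIncr p v → AllIncr p cs
    increasing-ungraftF s p (c ∷ cs) v∈ iv with graftF-inv s c cs v∈
    increasing-ungraftF s p (c ∷ cs) v∈ (au , iu , ics) | inHead u∈ = above-ungraft c u∈ au , increasing-ungraft s c u∈ iu , ics
    increasing-ungraftF s p (c ∷ cs) v∈ (ac , ic , iv) | inTail cs'∈ = ac , ic , increasing-ungraftF s p cs cs'∈ iv

  star : ℕ → ℕ → Tree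
  star L k = node L (replicate k leaf)

  star-increasing : ∀ L k → Increasing (star L k)
  star-increasing L zero    = tt
  star-increasing L (suc k) = tt , tt , star-increasing L k

  star-labels : ∀ L k → labels (star L k) ≡ L ∷ []
  star-labels L zero    = refl
  star-labels L (suc k) = star-labels L k

  star-internals : ∀ L k → internals (star L k) ≡ 1
  star-internals L k = cong length (star-labels L k)

  star-leaves : ∀ L k → leaves (star L k) ≡ k
  star-leaves L zero    = refl
  star-leaves L (suc k) = cong suc (star-leaves L k)

  star-X : ∀ L k → X (star L k) ≡ k
  star-X L zero    = refl
  star-X L (suc k) = cong suc (star-X L k)

  star-schroeder : ∀ L k → 2 ≤ k → IsSchroeder (star L k)
  star-schroeder L k two = subst (2 ≤_) (sym (LP.length-replicate k)) two , leaves-schroeder k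
    where
    leaves-schroeder : ∀ k → AllSchroeder (replicate k leaf)
    leaves-schroeder zero    = tt
    leaves-schroeder (suc k) = tt , leaves-schroeder k

  schroeder-star : ∀ L k → IsSchroeder (star L k) → 2 ≤ k
  schroeder-star L k (two , _) = subst (2 ≤_) (LP.length-replicate k) two

  -- grafting in the first child leaves no leaf in first position
  leafChildren-graft-head : ∀ L ks c cs {u} → u ∈ graft (node L ks) c → leafChildrenF (u ∷ cs) ≡ leafChildrenF cs
  leafChildren-graft-head L ks leaf cs (here refl) = refl
  leafChildren-graft-head L ks (node l ccs) cs u∈ with graft-node-inv {s = node L ks} {cs = ccs} u∈
  ... | _ , _ , refl = refl

  *-pred-suc : ∀ (h : ℕ → ℕ) x → x * h (suc (x ∸ 1)) ≡ x * h x
  *-pred-suc h zero    = refl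
  *-pred-suc h (suc x) = refl

  -- Among the leavesF cs grafts, the leafChildrenF cs ones at a leaf child of
  -- the root lower X by one and all others keep it:
  --   Σ_v h(X v) = Y·h(Y-1) + (leaves - Y)·h(Y)  with  Y = leafChildrenF cs,
  -- stated additively.
  X-graftF : ∀ (h : ℕ → ℕ) L ks cs → let Y = leafChildrenF cs in
    total (λ v → h (leafChildrenF v)) (graftF (node L ks) cs) + Y * h Y ≡ Y * h (Y ∸ 1) + leavesF cs * h Y
  X-graftF h L ks [] = refl
  X-graftF h L ks (leaf ∷ cs) = begin
      h Y + total (λ v → h (leafChildrenF v)) (map (leaf ∷_) (graftF s cs)) + suc Y * h (suc Y)
        ≡⟨ cong (λ z → h Y + z + suc Y * h (suc Y)) (total-map (λ v → h (leafChildrenF v)) (leaf ∷_) (graftF s cs)) ⟩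
      h Y + T + suc Y * h (suc Y)
        ≡⟨ regroup₁ (h Y) T Y (h (suc Y)) ⟩
      h Y + h (suc Y) + (T + Y * h (suc Y))
        ≡⟨ cong (h Y + h (suc Y) +_) (X-graftF (λ z → h (suc z)) L ks cs) ⟩
      h Y + h (suc Y) + (Y * h (suc (Y ∸ 1)) + m * h (suc Y))
        ≡⟨ cong (λ z → h Y + h (suc Y) + (z + m * h (suc Y))) (*-pred-suc h Y) ⟩
      h Y + h (suc Y) + (Y * h Y + m * h (suc Y))
        ≡⟨ regroup₂ (h Y) (h (suc Y)) Y m ⟩
      suc Y * h Y + suc m * h (suc Y) ∎
    where
    open ≡-Reasoning
    s = node L ks
    Y = leafChildrenF cs
    m = leavesF cs
    T = total (λ v → h (suc (leafChildrenF v))) (graftF s cs)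
    regroup₁ : ∀ a t x b → a + t + (1 + x) * b ≡ a + b + (t + x * b)
    regroup₁ = solve-∀
    regroup₂ : ∀ a b x m → a + b + (x * a + m * b) ≡ (1 + x) * a + (1 + m) * b
    regroup₂ = solve-∀
  X-graftF h L ks (node l ccs ∷ cs) = begin
      total H (map (_∷ cs) (graft s c) ++ map (c ∷_) (graftF s cs)) + Y * h Y
        ≡⟨ cong (_+ Y * h Y) (total-++ H (map (_∷ cs) (graft s c)) _) ⟩
      total H (map (_∷ cs) (graft s c)) + total H (map (c ∷_) (graftF s cs)) + Y * h Y
        ≡⟨ cong₂ (λ y z → y + z + Y * h Y) (total-map H (_∷ cs) (graft s c)) (total-map H (c ∷_) (graftF s cs)) ⟩
      total (λ u → H (u ∷ cs)) (graft s c) + T + Y * h Y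
        ≡⟨ cong (λ z → z + T + Y * h Y) (total-const (λ u → H (u ∷ cs)) (graft s c) (h Y)
                                          (λ u u∈ → cong h (leafChildren-graft-head L ks c cs u∈))) ⟩
      length (graft s c) * h Y + T + Y * h Y
        ≡⟨ cong (λ z → z * h Y + T + Y * h Y) (length-graft s c) ⟩
      leaves c * h Y + T + Y * h Y
        ≡⟨ NP.+-assoc (leaves c * h Y) T _ ⟩
      leaves c * h Y + (T + Y * h Y)
        ≡⟨ cong (leaves c * h Y +_) (X-graftF h L ks cs) ⟩
      leaves c * h Y + (Y * h (Y ∸ 1) + m * h Y)
        ≡⟨ regroup (leaves c) (h Y) Y (h (Y ∸ 1)) m ⟩
      Y * h (Y ∸ 1) + (leaves c + m) * h Y ∎
    where
    open ≡-Reasoning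
    s = node L ks
    c = node l ccs
    Y = leafChildrenF cs
    m = leavesF cs
    H = λ v → h (leafChildrenF v)
    T = total H (graftF s cs)
    regroup : ∀ lc a x b m → lc * a + (x * b + m * a) ≡ x * b + (lc + m) * a
    regroup = solve-∀

  -- h satisfies x·h(x) = x·h(x-1) + j·h(x); this holds for the falling
  -- factorials h(x) = x(x-1)⋯(x-j+1), in particular for 1, x and x(x-1)
  StepIdentity : (ℕ → ℕ) → ℕ → Set
  StepIdentity h j = ∀ x → x * h x ≡ x * h (x ∸ 1) + j * h x

  X-graft : ∀ h j → StepIdentity h j → ∀ L ks l cs → let t = node l cs in
    total (λ u → h (X u)) (graft (node L ks) t) + j * h (X t) ≡ leaves t * h (X t)
  X-graft h j step L ks l cs = NP.+-cancelˡ-≡ (Y * h (Y ∸ 1)) _ _ (begin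
      Y * h (Y ∸ 1) + (total (λ u → h (X u)) (map (node l) (graftF s cs)) + j * h Y)
        ≡⟨ cong (λ z → Y * h (Y ∸ 1) + (z + j * h Y)) (total-map (λ u → h (X u)) (node l) (graftF s cs)) ⟩
      Y * h (Y ∸ 1) + (T + j * h Y)     ≡⟨ +-exchange (Y * h (Y ∸ 1)) T (j * h Y) ⟩
      T + (Y * h (Y ∸ 1) + j * h Y)     ≡⟨ cong (T +_) (sym (step Y)) ⟩
      T + Y * h Y                       ≡⟨ X-graftF h L ks cs ⟩
      Y * h (Y ∸ 1) + leavesF cs * h Y  ∎)
    where
    open ≡-Reasoning
    s = node L ks
    Y = leafChildrenF cs
    T = total (λ v → h (leafChildrenF v)) (graftF s cs)

  mutual
    collapse : ℕ → Tree → Tree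
    collapse L leaf = leaf
    collapse L (node l cs) with l ≟ L
    ... | yes _ = leaf
    ... | no _  = node l (collapseF L cs)

    collapseF : ℕ → List Tree → List Tree
    collapseF L []       = []
    collapseF L (c ∷ cs) = collapse L c ∷ collapseF L cs

  ∉-++ˡ : ∀ {L : ℕ} xs {ys} → L ∉ xs ++ ys → L ∉ xs
  ∉-++ˡ xs L∉ L∈ = L∉ (∈-++⁺ˡ L∈)

  ∉-++ʳ : ∀ {L : ℕ} xs {ys} → L ∉ xs ++ ys → L ∉ ys
  ∉-++ʳ xs L∉ L∈ = L∉ (∈-++⁺ʳ xs L∈)

  mutual
    collapse-absent : ∀ L t → L ∉ labels t → collapse L t ≡ t
    collapse-absent L leaf _ = refl
    collapse-absent L (node l cs) L∉ with l ≟ L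
    ... | yes refl = ⊥-elim (L∉ (here refl))
    ... | no _     = cong (node l) (collapseF-absent L cs (λ L∈ → L∉ (there L∈)))

    collapseF-absent : ∀ L cs → L ∉ labelsF cs → collapseF L cs ≡ cs
    collapseF-absent L [] _ = refl
    collapseF-absent L (c ∷ cs) L∉ =
      cong₂ _∷_ (collapse-absent L c (∉-++ˡ (labels c) L∉)) (collapseF-absent L cs (∉-++ʳ (labels c) L∉))

  mutual
    collapse-graft : ∀ L ks t {u} → u ∈ graft (node L ks) t → L ∉ labels t → collapse L u ≡ t
    collapse-graft L ks leaf (here refl) _ with L ≟ L
    ... | yes _ = refl
    ... | no L≢L = ⊥-elim (L≢L refl)
    collapse-graft L ks (node l cs) u∈ L∉ with graft-node-inv {s = node L ks} {cs = cs} u∈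
    ... | cs' , cs'∈ , refl with l ≟ L
    ...   | yes refl = ⊥-elim (L∉ (here refl))
    ...   | no _     = cong (node l) (collapse-graftF L ks cs cs'∈ (λ L∈ → L∉ (there L∈)))

    collapse-graftF : ∀ L ks cs {v} → v ∈ graftF (node L ks) cs → L ∉ labelsF cs → collapseF L v ≡ cs
    collapse-graftF L ks (c ∷ cs) v∈ L∉ with graftF-inv (node L ks) c cs v∈
    ... | inHead u∈ = cong₂ _∷_ (collapse-graft L ks c u∈ (∉-++ˡ (labels c) L∉)) (collapseF-absent L cs (∉-++ʳ (labels c) L∉))
    ... | inTail cs'∈ = cong₂ _∷_ (collapse-absent L c (∉-++ˡ (labels c) L∉)) (collapse-graftF L ks cs cs'∈ (∉-++ʳ (labels c) L∉))

  graft-is-node : ∀ L ks t {u} → u ∈ graft (node L ks) t → Σ ℕ λ l → Σ (List Tree) λ cs → u ≡ node l cs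
  graft-is-node L ks leaf (here refl) = L , ks , refl
  graft-is-node L ks (node l cs) u∈ with graft-node-inv {s = node L ks} {cs = cs} u∈
  ... | cs' , _ , refl = l , cs' , refl

  graft-has-label : ∀ L ks t {u} → u ∈ graft (node L ks) t → L ∈ labels u
  graft-has-label L ks t u∈ = PermP.∈-resp-↭ (↭-sym (labels-graft (node L ks) t u∈)) (here refl)

  node-injective : ∀ {l cs cs'} → node l cs ≡ node l cs' → cs ≡ cs'
  node-injective refl = refl

  mutual
    graft-unique : ∀ L ks t → L ∉ labels t → Unique (graft (node L ks) t)
    graft-unique L ks leaf _ = [] AllPairs.∷ AllPairs.[]
    graft-unique L ks (node l cs) L∉ = UniqueP.map⁺ node-injective (graftF-unique L ks cs (λ L∈ → L∉ (there L∈)))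

    graftF-unique : ∀ L ks cs → L ∉ labelsF cs → Unique (graftF (node L ks) cs)
    graftF-unique L ks [] _ = AllPairs.[]
    graftF-unique L ks (c ∷ cs) L∉ =
      UniqueP.++⁺ (UniqueP.map⁺ (λ e → proj₁ (LP.∷-injective e)) (graft-unique L ks c (∉-++ˡ (labels c) L∉)))
                  (UniqueP.map⁺ (λ e → proj₂ (LP.∷-injective e)) (graftF-unique L ks cs (∉-++ʳ (labels c) L∉)))
                  disjoint
      where
      -- grafting in the head puts L into the head, which is absent otherwise
      disjoint : ∀ {v} → ¬ (v ∈ map (_∷ cs) (graft (node L ks) c) × v ∈ map (c ∷_) (graftF (node L ks) cs))
      disjoint (v∈hd , v∈tl) with ∈-map⁻ (_∷ cs) v∈hd | ∈-map⁻ (c ∷_) v∈tl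
      ... | u , u∈ , refl | _ , _ , e =
        ∉-++ˡ (labels c) L∉ (subst (λ z → L ∈ labels z) (proj₁ (LP.∷-injective e)) (graft-has-label L ks c u∈))

  -- Ungrafting the maximal label.  In an increasing tree the node carrying the
  -- largest label L has only leaf children, so the tree is a star labelled L
  -- grafted on some tree.

  mutual
    only-leaves : ∀ l cs → AllIncr l cs → All (_≤ l) (labelsF cs) → cs ≡ replicate (length cs) leaf
    only-leaves l [] _ _ = refl
    only-leaves l (leaf ∷ cs) (_ , _ , ai) al = cong (leaf ∷_) (only-leaves l cs ai al)
    only-leaves l (node l' ccs ∷ cs) (l<l' , _ , _) (l'≤l ∷ _) = ⊥-elim (NP.<⇒≱ l<l' l'≤l)

  mutual
    ungraft-max : ∀ L u → L ∈ labels u → All (_≤ L) (labels u) → Increasing u →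
                  Σ Tree λ t → Σ ℕ λ k → u ∈ graft (star L k) t
    ungraft-max L (node l cs) (here refl) (_ ∷ al) iu = leaf , length cs , here (cong (node L) (only-leaves L cs iu al))
    ungraft-max L (node l cs) (there L∈) (_ ∷ al) iu with ungraftF-max L l cs L∈ al iu
    ... | cs' , k , cs∈ = node l cs' , k , graft-node {s = star L k} {cs = cs'} cs∈

    ungraftF-max : ∀ L p cs → L ∈ labelsF cs → All (_≤ L) (labelsF cs) → AllIncr p cs →
                   Σ (List Tree) λ cs' → Σ ℕ λ k → cs ∈ graftF (star L k) cs'
    ungraftF-max L p (c ∷ cs) L∈ al (_ , ic , ai) with ∈-++⁻ (labels c) L∈
    ... | inj₁ L∈c with ungraft-max L c L∈c (AllP.++⁻ˡ (labels c) al) ic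
    ...   | t , k , c∈ = t ∷ cs , k , graftF-head cs c∈
    ungraftF-max L p (c ∷ cs) L∈ al (_ , ic , ai) | inj₂ L∈cs with ungraftF-max L p cs L∈cs (AllP.++⁻ʳ (labels c) al) ai
    ...   | cs' , k , cs∈ = c ∷ cs' , k , graftF-tail cs∈

  labelSet : ℕ → List ℕ
  labelSet ℓ = map suc (upTo ℓ)

  labelSet-suc : ∀ ℓ → labelSet (suc ℓ) ↭ suc ℓ ∷ labelSet ℓ
  labelSet-suc ℓ = begin
    map suc (upTo (suc ℓ))        ≡⟨ cong (map suc) (sym (LP.upTo-∷ʳ ℓ)) ⟩
    map suc (upTo ℓ ∷ʳ ℓ)         ≡⟨ LP.map-++ suc (upTo ℓ) (ℓ ∷ []) ⟩
    labelSet ℓ ++ (suc ℓ ∷ [])    ↭⟨ PermP.++-comm (labelSet ℓ) (suc ℓ ∷ []) ⟩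
    suc ℓ ∷ labelSet ℓ            ∎
    where open PermutationReasoning

  length-labelSet : ∀ ℓ → length (labelSet ℓ) ≡ ℓ
  length-labelSet ℓ = trans (LP.length-map suc (upTo ℓ)) (LP.length-upTo ℓ)

  labelSet-bound : ∀ ℓ → All (_< suc ℓ) (labelSet ℓ)
  labelSet-bound ℓ = All.tabulate bound
    where
    bound : ∀ {x} → x ∈ labelSet ℓ → x < suc ℓ
    bound x∈ with ∈-map⁻ suc x∈
    ... | _ , i∈ , refl = s≤s (∈-upTo⁻ i∈)

  labelSet-fresh : ∀ ℓ → suc ℓ ∉ labelSet ℓ
  labelSet-fresh ℓ ℓ+1∈ = NP.<-irrefl refl (All.lookup (labelSet-bound ℓ) ℓ+1∈)

  labelSet-top : ∀ ℓ → suc ℓ ∈ labelSet (suc ℓ)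
  labelSet-top ℓ = ∈-map⁺ suc (∈-upTo⁺ (NP.n<1+n ℓ))

  SIST : ℕ → Tree → Set
  SIST n t = IsSIST t × leaves t ≡ n

  leaves-positive : ∀ t → IsSchroeder t → 1 ≤ leaves t
  leaves-positive leaf _ = s≤s z≤n
  leaves-positive (node l (c ∷ cs)) (_ , sc , _) = NP.≤-trans (leaves-positive c sc) (NP.m≤m+n (leaves c) _)

  leafOnly : ℕ → List Tree
  leafOnly (suc zero) = leaf ∷ []
  leafOnly _          = []

  grafts : ℕ → ℕ → Tree → List Tree
  grafts n m t = graft (star (suc (internals t)) (suc (n ∸ m))) t

  -- sistsUpTo f n lists the SISTs with n leaves, provided n ≤ f; the fuel f
  -- makes the recursion on the number of leaves structural
  sistsUpTo : ℕ → ℕ → List Tree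
  sistsUpTo zero    n = []
  sistsUpTo (suc f) n = leafOnly n ++ concatMap (λ m → concatMap (grafts n m) (sistsUpTo f m)) (upTo n)

  sists : ℕ → List Tree
  sists n = sistsUpTo n n

  leafOnly-sound : ∀ n {u} → u ∈ leafOnly n → SIST n u
  leafOnly-sound (suc zero) (here refl) = (tt , ↭-refl , tt) , refl

  -- leaf counts of a graft: m + (n-m+1) = n + 1
  graft-size : ∀ n m k → m < n → k ≡ suc (n ∸ m) → ∀ x → x + 1 ≡ k + m → x ≡ n
  graft-size n m k m<n refl x e = NP.suc-injective (trans (trans (NP.+-comm 1 x) e) (cong suc (NP.m∸n+n≡m (NP.<⇒≤ m<n))))

  ungraft-size : ∀ n m k → 2 ≤ k → n + 1 ≡ k + m → m < n × suc (n ∸ m) ≡ k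
  ungraft-size n m (suc zero) (s≤s ()) e
  ungraft-size n m (suc (suc k)) _ e = m<n , cong suc (trans (cong (_∸ m) n≡) (NP.m+n∸n≡m (suc k) m))
    where
    n≡ : n ≡ suc k + m
    n≡ = NP.suc-injective (trans (NP.+-comm 1 n) e)
    m<n : m < n
    m<n = subst (m <_) (sym n≡) (s≤s (NP.m≤n+m m k))

  grafts-sound : ∀ n m t {u} → m < n → SIST m t → u ∈ grafts n m t → SIST n u
  grafts-sound n m t {u} m<n ((st , lt , it) , refl) u∈ = (schroeder , labelsOK , increasing) , size
    where
    ℓ = internals t
    k = suc (n ∸ m)
    s = star (suc ℓ) k
    schroeder = schroeder-graft s t u∈ (star-schroeder (suc ℓ) k (s≤s (NP.m<n⇒0<n∸m m<n))) st
    labels-u : labels u ↭ labelSet (suc ℓ)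
    labels-u = ↭-trans (labels-graft s t u∈)
                 (subst (λ z → z ++ labels t ↭ labelSet (suc ℓ)) (sym (star-labels (suc ℓ) k))
                   (↭-trans (prep (suc ℓ) lt) (↭-sym (labelSet-suc ℓ))))
    internals-u : internals u ≡ suc ℓ
    internals-u = trans (PermP.↭-length labels-u) (length-labelSet (suc ℓ))
    labelsOK : labels u ↭ labelSet (internals u)
    labelsOK = subst (λ z → labels u ↭ labelSet z) (sym internals-u) labels-u
    increasing = increasing-graft s t u∈ (star-increasing (suc ℓ) k) it (PermP.All-resp-↭ (↭-sym lt) (labelSet-bound ℓ))
    size : leaves u ≡ n
    size = graft-size n m k m<n refl (leaves u) (trans (leaves-graft s t u∈) (cong (_+ m) (star-leaves (suc ℓ) k)))

  sistsUpTo-sound : ∀ f n {u} → u ∈ sistsUpTo f n → SIST n u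
  sistsUpTo-sound (suc f) n {u} u∈ with ∈-++⁻ (leafOnly n) u∈
  ... | inj₁ u∈leaf = leafOnly-sound n u∈leaf
  ... | inj₂ u∈grafts with find (∈-concatMap⁻ _ {xs = upTo n} u∈grafts)
  ...   | m , m∈ , u∈m with find (∈-concatMap⁻ (grafts n m) {xs = sistsUpTo f m} u∈m)
  ...     | t , t∈ , u∈t = grafts-sound n m t (∈-upTo⁻ m∈) (sistsUpTo-sound f m t∈) u∈t

  sist-fresh : ∀ t → IsSIST t → suc (internals t) ∉ labels t
  sist-fresh t (_ , lt , _) L∈ = labelSet-fresh (internals t) (PermP.∈-resp-↭ lt L∈)

  collapse-grafts : ∀ n m t {v} → IsSIST t → v ∈ grafts n m t → collapse (internals v) v ≡ t
  collapse-grafts n m t {v} st v∈ = subst (λ z → collapse z v ≡ t) (sym internals-v) (collapse-graft (suc (internals t)) _ t v∈ (sist-fresh t st))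
    where
    internals-v : internals v ≡ suc (internals t)
    internals-v = trans (internals-graft (star (suc (internals t)) (suc (n ∸ m))) t v∈)
                        (cong (_+ internals t) (star-internals (suc (internals t)) (suc (n ∸ m))))

  ungraft-sist : ∀ n l cs → SIST n (node l cs) → let u = node l cs in
                 Σ Tree λ t → leaves t < n × SIST (leaves t) t × u ∈ grafts n (leaves t) t
  ungraft-sist n l cs ((su , lu , iu) , refl) = t , m<n , (st , refl) , u∈grafts
    where
    u = node l cs
    ℓ = length (labelsF cs)
    L = suc ℓ
    maximal = ungraft-max L u (PermP.∈-resp-↭ (↭-sym lu) (labelSet-top ℓ))
                (PermP.All-resp-↭ (↭-sym lu) (All.map NP.≤-pred (labelSet-bound L))) iu
    t = proj₁ maximal
    k = proj₁ (proj₂ maximal)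
    u∈ : u ∈ graft (star L k) t
    u∈ = proj₂ (proj₂ maximal)
    labels-t : labels t ↭ labelSet ℓ
    labels-t = PermP.drop-∷ (↭-trans (subst (λ z → z ++ labels t ↭ labels u) (star-labels L k) (↭-sym (labels-graft (star L k) t u∈)))
                                     (↭-trans lu (labelSet-suc ℓ)))
    internals-t : internals t ≡ ℓ
    internals-t = trans (PermP.↭-length labels-t) (length-labelSet ℓ)
    schroeder = schroeder-ungraft (star L k) t u∈ su
    st : IsSIST t
    st = proj₁ schroeder , subst (λ z → labels t ↭ labelSet z) (sym internals-t) labels-t , increasing-ungraft (star L k) t u∈ iu
    sizes = ungraft-size (leaves u) (leaves t) k (schroeder-star L k (proj₂ schroeder))
              (trans (leaves-graft (star L k) t u∈) (cong (_+ leaves t) (star-leaves L k)))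
    m<n = proj₁ sizes
    u∈grafts : u ∈ grafts (leaves u) (leaves t) t
    u∈grafts = subst₂ (λ a b → u ∈ graft (star (suc a) b) t) (sym internals-t) (sym (proj₂ sizes)) u∈

  sistsUpTo-complete : ∀ f n u → SIST n u → n ≤ f → u ∈ sistsUpTo f n
  sistsUpTo-complete zero n u ((su , _ , _) , refl) n≤0 = ⊥-elim (NP.<⇒≱ (leaves-positive u su) n≤0)
  sistsUpTo-complete (suc f) n leaf (_ , refl) _ = here refl
  sistsUpTo-complete (suc f) n (node l cs) sist n≤f with ungraft-sist n l cs sist
  ... | t , m<n , sist-t , u∈ =
    ∈-++⁺ʳ (leafOnly n) (∈-concatMap⁺ _ (lose (∈-upTo⁺ m<n)
      (∈-concatMap⁺ (grafts n (leaves t)) (lose (sistsUpTo-complete f (leaves t) t sist-t (NP.≤-pred (NP.≤-trans m<n n≤f))) u∈))))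

  leafOnly-unique : ∀ n → Unique (leafOnly n)
  leafOnly-unique zero          = AllPairs.[]
  leafOnly-unique (suc zero)    = [] AllPairs.∷ AllPairs.[]
  leafOnly-unique (suc (suc n)) = AllPairs.[]

  leafOnly-leaf : ∀ n {v} → v ∈ leafOnly n → v ≡ leaf
  leafOnly-leaf (suc zero) (here refl) = refl

  -- grafts on different trees, or of different sizes, are different: the
  -- tree and its size are recovered by collapsing the largest label
  sistsUpTo-unique : ∀ f n → Unique (sistsUpTo f n)
  sistsUpTo-unique zero n = AllPairs.[]
  sistsUpTo-unique (suc f) n =
    UniqueP.++⁺ (leafOnly-unique n) (concatMap-unique _ (upTo n) (UniqueP.upTo⁺ n) (λ m _ → block-unique m) size size-correct) disjoint
    where
    recover : Tree → Tree
    recover v = collapse (internals v) v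
    block-unique : ∀ m → Unique (concatMap (grafts n m) (sistsUpTo f m))
    block-unique m = concatMap-unique (grafts n m) (sistsUpTo f m) (sistsUpTo-unique f m)
       (λ t t∈ → graft-unique _ _ t (sist-fresh t (proj₁ (sistsUpTo-sound f m t∈))))
       recover (λ t v t∈ v∈ → collapse-grafts n m t (proj₁ (sistsUpTo-sound f m t∈)) v∈)
    size : Tree → ℕ
    size v = leaves (recover v)
    size-correct : ∀ m v → m ∈ upTo n → v ∈ concatMap (grafts n m) (sistsUpTo f m) → size v ≡ m
    size-correct m v _ v∈ with find (∈-concatMap⁻ (grafts n m) {xs = sistsUpTo f m} v∈)
    ... | t , t∈ , v∈t = trans (cong leaves (collapse-grafts n m t (proj₁ (sistsUpTo-sound f m t∈)) v∈t)) (proj₂ (sistsUpTo-sound f m t∈))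
    disjoint : ∀ {v} → ¬ (v ∈ leafOnly n × v ∈ concatMap (λ m → concatMap (grafts n m) (sistsUpTo f m)) (upTo n))
    disjoint (v∈leaf , v∈grafts) with find (∈-concatMap⁻ _ {xs = upTo n} v∈grafts)
    ... | m , _ , v∈m with find (∈-concatMap⁻ (grafts n m) {xs = sistsUpTo f m} v∈m)
    ...   | t , _ , v∈t with graft-is-node _ _ t v∈t | leafOnly-leaf n v∈leaf
    ...     | _ , _ , refl | ()

  sistsUpTo-members : ∀ f n → n ≤ f → ∀ t → t ∈ sistsUpTo f n ⇔ SIST n t
  sistsUpTo-members f n n≤f t = mk⇔ (sistsUpTo-sound f n) (λ sist → sistsUpTo-complete f n t sist n≤f)

  total-enumeration : ∀ (h : Tree → ℕ) n L → Enumerates n L → total h L ≡ total h (sists n)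
  total-enumeration h n L (uL , eL) =
    total-↭ h (same-members-↭ (SIST n) uL (sistsUpTo-unique n n) eL (sistsUpTo-members n n NP.≤-refl))

  total-fuel : ∀ (h : Tree → ℕ) f g n → n ≤ f → n ≤ g → total h (sistsUpTo f n) ≡ total h (sistsUpTo g n)
  total-fuel h f g n n≤f n≤g =
    total-↭ h (same-members-↭ (SIST n) (sistsUpTo-unique f n) (sistsUpTo-unique g n) (sistsUpTo-members f n n≤f) (sistsUpTo-members g n n≤g))

  F : (ℕ → ℕ) → ℕ → ℕ
  F h n = total (λ t → h (X t)) (sists n)

  sistsUpTo-0 : ∀ f → sistsUpTo f 0 ≡ []
  sistsUpTo-0 zero    = refl
  sistsUpTo-0 (suc f) = refl

  -- Σ_{2 ≤ m < 2+k} g m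
  Σ₂ : ℕ → (ℕ → ℕ) → ℕ
  Σ₂ k g = total (λ i → g (2 + i)) (upTo k)

  Σ₂-suc : ∀ k g → Σ₂ (suc k) g ≡ Σ₂ k g + g (2 + k)
  Σ₂-suc k g = total-upTo-suc (λ i → g (2 + i)) k

  module Recurrence (h : ℕ → ℕ) (j : ℕ) (step : StepIdentity h j) where

    H : Tree → ℕ
    H t = h (X t)

    block : ℕ → ℕ → ℕ → ℕ
    block n f m = total H (concatMap (grafts n m) (sistsUpTo f m))

    grafts-contribution : ∀ n f m t → t ∈ sistsUpTo f m → 2 ≤ m → total H (grafts n m t) + j * H t ≡ m * H t
    grafts-contribution n f m leaf t∈ two with sistsUpTo-sound f m t∈
    ... | _ , refl = ⊥-elim (NP.<-irrefl refl (NP.≤-pred two))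
    grafts-contribution n f m (node l cs) t∈ two with sistsUpTo-sound f m t∈
    ... | _ , refl = X-graft h j step (suc (internals (node l cs))) (replicate (suc (n ∸ m)) leaf) l cs

    block-≥2 : ∀ n f m → 2 ≤ m → m ≤ f → block n f m + j * F h m ≡ m * F h m
    block-≥2 n f m two m≤f = begin
        block n f m + j * F h m
          ≡⟨ cong₂ (λ a b → a + j * b) (total-concatMap H (grafts n m) ts) (total-fuel H m f m NP.≤-refl m≤f) ⟩
        total (λ t → total H (grafts n m t)) ts + j * total H ts
          ≡⟨ cong (total (λ t → total H (grafts n m t)) ts +_) (sym (total-*ˡ j H ts)) ⟩
        total (λ t → total H (grafts n m t)) ts + total (λ t → j * H t) ts
          ≡⟨ sym (total-+ _ _ ts) ⟩
        total (λ t → total H (grafts n m t) + j * H t) ts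
          ≡⟨ total-cong ts (λ t t∈ → grafts-contribution n f m t t∈ two) ⟩
        total (λ t → m * H t) ts
          ≡⟨ total-*ˡ m H ts ⟩
        m * total H ts
          ≡⟨ cong (m *_) (total-fuel H f m m m≤f NP.≤-refl) ⟩
        m * F h m ∎
      where
      open ≡-Reasoning
      ts = sistsUpTo f m

    block-0 : ∀ n f → block n f 0 ≡ 0
    block-0 n f rewrite sistsUpTo-0 f = refl

    -- grafting on the single leaf gives the star, with X = n
    block-1 : ∀ k → block (2 + k) (suc k) 1 ≡ h (2 + k)
    block-1 zero    = trans (NP.+-identityʳ _) (cong h (star-X 1 2))
    block-1 (suc k) = trans (NP.+-identityʳ _) (cong h (star-X 1 (3 + k)))

    F-blocks : ∀ k → F h (2 + k) ≡ h (2 + k) + Σ₂ k (block (2 + k) (suc k))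
    F-blocks k = begin
        F h (2 + k)
          ≡⟨ total-concatMap H (λ m → concatMap (grafts (2 + k) m) (sistsUpTo (suc k) m)) (upTo (2 + k)) ⟩
        B 0 + (B 1 + total B (applyUpTo (λ i → 2 + i) k))
          ≡⟨ cong₂ (λ a b → a + (b + total B (applyUpTo (λ i → 2 + i) k))) (block-0 (2 + k) (suc k)) (block-1 k) ⟩
        h (2 + k) + total B (applyUpTo (λ i → 2 + i) k)
          ≡⟨ cong (λ z → h (2 + k) + total B z) (sym (LP.map-upTo (λ i → 2 + i) k)) ⟩
        h (2 + k) + total B (map (λ i → 2 + i) (upTo k))
          ≡⟨ cong (h (2 + k) +_) (total-map B (λ i → 2 + i) (upTo k)) ⟩
        h (2 + k) + Σ₂ k B ∎
      where
      open ≡-Reasoning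
      B = block (2 + k) (suc k)

    F-unrolled : ∀ k → F h (2 + k) + j * Σ₂ k (F h) ≡ h (2 + k) + Σ₂ k (λ m → m * F h m)
    F-unrolled k = begin
        F h (2 + k) + j * Σ₂ k (F h)
          ≡⟨ cong (_+ j * Σ₂ k (F h)) (F-blocks k) ⟩
        h (2 + k) + Σ₂ k B + j * Σ₂ k (F h)
          ≡⟨ NP.+-assoc (h (2 + k)) _ _ ⟩
        h (2 + k) + (Σ₂ k B + j * Σ₂ k (F h))
          ≡⟨ cong (λ z → h (2 + k) + (Σ₂ k B + z)) (sym (total-*ˡ j (λ i → F h (2 + i)) (upTo k))) ⟩
        h (2 + k) + (Σ₂ k B + Σ₂ k (λ m → j * F h m))
          ≡⟨ cong (h (2 + k) +_) (sym (total-+ (λ i → B (2 + i)) (λ i → j * F h (2 + i)) (upTo k))) ⟩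
        h (2 + k) + Σ₂ k (λ m → B m + j * F h m)
          ≡⟨ cong (h (2 + k) +_) (total-cong (upTo k) (λ i i∈ → block-≥2 (2 + k) (suc k) (2 + i) (s≤s (s≤s z≤n)) (s≤s (∈-upTo⁻ i∈)))) ⟩
        h (2 + k) + Σ₂ k (λ m → m * F h m) ∎
      where
      open ≡-Reasoning
      B = block (2 + k) (suc k)

    -- differencing consecutive instances:
    -- Fₕ(n+1) + j·Fₕ(n) + h(n) = h(n+1) + (n+1)·Fₕ(n)
    F-step : ∀ k → F h (3 + k) + j * F h (2 + k) + h (2 + k) ≡ h (3 + k) + (3 + k) * F h (2 + k)
    F-step k = NP.+-cancelʳ-≡ P _ _ (begin
        a + j * b + h (2 + k) + P             ≡⟨ regroup₁ a (j * b) (h (2 + k)) P ⟩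
        a + j * b + (h (2 + k) + P)           ≡⟨ cong (a + j * b +_) (sym (F-unrolled k)) ⟩
        a + j * b + (b + j * S)               ≡⟨ regroup₂ a j b S ⟩
        a + j * (S + b) + b                   ≡⟨ cong (λ z → a + j * z + b) (sym (Σ₂-suc k (F h))) ⟩
        a + j * Σ₂ (suc k) (F h) + b          ≡⟨ cong (_+ b) (F-unrolled (suc k)) ⟩
        h (3 + k) + Σ₂ (suc k) (λ m → m * F h m) + b
                                              ≡⟨ cong (λ z → h (3 + k) + z + b) (Σ₂-suc k (λ m → m * F h m)) ⟩
        h (3 + k) + (P + (2 + k) * b) + b     ≡⟨ regroup₃ (h (3 + k)) P k b ⟩
        h (3 + k) + (3 + k) * b + P           ∎)
      where
      open ≡-Reasoning
      a = F h (3 + k)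
      b = F h (2 + k)
      S = Σ₂ k (F h)
      P = Σ₂ k (λ m → m * F h m)
      regroup₁ : ∀ a x y p → a + x + y + p ≡ a + x + (y + p)
      regroup₁ = solve-∀
      regroup₂ : ∀ a j b s → a + j * b + (b + j * s) ≡ a + j * (s + b) + b
      regroup₂ = solve-∀
      regroup₃ : ∀ x p k b → x + (p + (2 + k) * b) + b ≡ x + (3 + k) * b + p
      regroup₃ = solve-∀

    F-2 : F h 2 ≡ h 2
    F-2 = trans (sym (trans (cong (F h 2 +_) (NP.*-zeroʳ j)) (NP.+-identityʳ (F h 2)))) (trans (F-unrolled 0) (NP.+-identityʳ (h 2)))

  -- number of SISTs: n!/2
  numSists : ℕ → ℕ
  numSists zero    = 1
  numSists (suc k) = (3 + k) * numSists k

  -- j!·e_j = Σ_{i≤j} j!/i!; the total of X is (n-1)!·e_{n-1}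
  eNumerator : ℕ → ℕ
  eNumerator zero    = 1
  eNumerator (suc j) = 1 + suc j * eNumerator j

  sumFalling : ℕ → ℕ
  sumFalling zero    = 2
  sumFalling (suc k) = (1 + k) * sumFalling k + 2 * (2 + k)

  falling : ℕ → ℕ
  falling x = x * (x ∸ 1)

  step-const : StepIdentity (λ _ → 1) 0
  step-const x = sym (NP.+-identityʳ _)

  step-id : StepIdentity (λ x → x) 1
  step-id zero    = refl
  step-id (suc y) = identity y
    where
    identity : ∀ y → (1 + y) * (1 + y) ≡ (1 + y) * y + 1 * (1 + y)
    identity = solve-∀

  step-falling : StepIdentity falling 2
  step-falling zero          = refl
  step-falling (suc zero)    = refl
  step-falling (suc (suc y)) = identity y
    where
    identity : ∀ y → (2 + y) * ((2 + y) * (1 + y)) ≡ (2 + y) * ((1 + y) * y) + 2 * ((2 + y) * (1 + y))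
    identity = solve-∀

  module Count   = Recurrence (λ _ → 1) 0 step-const
  module SumX    = Recurrence (λ x → x) 1 step-id
  module SumFall = Recurrence falling 2 step-falling

  F-const : ∀ k → F (λ _ → 1) (2 + k) ≡ numSists k
  F-const zero    = Count.F-2
  F-const (suc k) = NP.+-cancelʳ-≡ 1 _ _ (begin
      F (λ _ → 1) (3 + k) + 1                ≡⟨ cong (_+ 1) (sym (NP.+-identityʳ (F (λ _ → 1) (3 + k)))) ⟩
      F (λ _ → 1) (3 + k) + 0 + 1            ≡⟨ Count.F-step k ⟩
      1 + (3 + k) * F (λ _ → 1) (2 + k)      ≡⟨ NP.+-comm 1 _ ⟩
      (3 + k) * F (λ _ → 1) (2 + k) + 1      ≡⟨ cong (λ z → (3 + k) * z + 1) (F-const k) ⟩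
      numSists (suc k) + 1 ∎)
    where open ≡-Reasoning

  F-id : ∀ k → F (λ x → x) (2 + k) ≡ eNumerator (suc k)
  F-id zero    = SumX.F-2
  F-id (suc k) = NP.+-cancelʳ-≡ (b + (2 + k)) _ _ (begin
      a + (b + (2 + k))                      ≡⟨ regroup₁ a b k ⟩
      a + 1 * b + (2 + k)                    ≡⟨ SumX.F-step k ⟩
      (3 + k) + (3 + k) * b                  ≡⟨ regroup₂ k b ⟩
      1 + (2 + k) * b + (b + (2 + k))        ≡⟨ cong (λ z → 1 + (2 + k) * z + (b + (2 + k))) (F-id k) ⟩
      eNumerator (2 + k) + (b + (2 + k))     ∎)
    where
    open ≡-Reasoning
    a = F (λ x → x) (3 + k)
    b = F (λ x → x) (2 + k)
    regroup₁ : ∀ a b k → a + (b + (2 + k)) ≡ a + 1 * b + (2 + k)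
    regroup₁ = solve-∀
    regroup₂ : ∀ k b → (3 + k) + (3 + k) * b ≡ 1 + (2 + k) * b + (b + (2 + k))
    regroup₂ = solve-∀

  F-falling : ∀ k → F falling (2 + k) ≡ sumFalling k
  F-falling zero    = SumFall.F-2
  F-falling (suc k) = NP.+-cancelʳ-≡ (2 * b + (2 + k) * (1 + k)) _ _ (begin
      a + (2 * b + (2 + k) * (1 + k))        ≡⟨ regroup₁ a b k ⟩
      a + 2 * b + falling (2 + k)            ≡⟨ SumFall.F-step k ⟩
      falling (3 + k) + (3 + k) * b          ≡⟨ regroup₂ k b ⟩
      (1 + k) * b + 2 * (2 + k) + (2 * b + (2 + k) * (1 + k))
        ≡⟨ cong (λ z → (1 + k) * z + 2 * (2 + k) + (2 * b + (2 + k) * (1 + k))) (F-falling k) ⟩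
      sumFalling (suc k) + (2 * b + (2 + k) * (1 + k)) ∎)
    where
    open ≡-Reasoning
    a = F falling (3 + k)
    b = F falling (2 + k)
    regroup₁ : ∀ a b k → a + (2 * b + (2 + k) * (1 + k)) ≡ a + 2 * b + (2 + k) * (1 + k)
    regroup₁ = solve-∀
    regroup₂ : ∀ k b → (3 + k) * (2 + k) + (3 + k) * b ≡ (1 + k) * b + 2 * (2 + k) + (2 * b + (2 + k) * (1 + k))
    regroup₂ = solve-∀

  module Moments (k : ℕ) (L : List Tree) (enum : Enumerates (2 + k) L) where

    length-L : length L ≡ numSists k
    length-L = begin
      length L                 ≡⟨ sym (NP.*-identityʳ (length L)) ⟩
      length L * 1             ≡⟨ sym (total-const (λ _ → 1) L 1 (λ _ _ → refl)) ⟩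
      total (λ _ → 1) L        ≡⟨ total-enumeration (λ _ → 1) (2 + k) L enum ⟩
      F (λ _ → 1) (2 + k)      ≡⟨ F-const k ⟩
      numSists k               ∎
      where open ≡-Reasoning

    sum-X : sum (map X L) ≡ eNumerator (suc k)
    sum-X = trans (total-enumeration X (2 + k) L enum) (F-id k)

    -- x² = x(x-1) + x
    sum-X² : sum (map (λ t → X t * X t) L) ≡ sumFalling k + eNumerator (suc k)
    sum-X² = begin
      total (λ t → X t * X t) L             ≡⟨ total-cong L (λ t _ → square (X t)) ⟩
      total (λ t → falling (X t) + X t) L   ≡⟨ total-+ (λ t → falling (X t)) X L ⟩
      total (λ t → falling (X t)) L + total X L
        ≡⟨ cong₂ _+_ (total-enumeration (λ t → falling (X t)) (2 + k) L enum) sum-X ⟩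
      F falling (2 + k) + eNumerator (suc k) ≡⟨ cong (_+ eNumerator (suc k)) (F-falling k) ⟩
      sumFalling k + eNumerator (suc k)      ∎
      where
      open ≡-Reasoning
      square : ∀ x → x * x ≡ falling x + x
      square x = trans (step-id x) (cong (falling x +_) (NP.+-identityʳ x))

  numSists-factorial : ∀ k → 2 * numSists k ≡ (2 + k) !
  numSists-factorial zero    = refl
  numSists-factorial (suc k) = trans (swap-factors (numSists k) k) (cong ((3 + k) *_) (numSists-factorial k))
    where
    swap-factors : ∀ c k → 2 * ((3 + k) * c) ≡ (3 + k) * (2 * c)
    swap-factors = solve-∀

  eNumerator-bound : ∀ k → (2 + k) * eNumerator (suc k) + 2 ≤ 6 * numSists k
  eNumerator-bound zero    = NP.≤-refl
  eNumerator-bound (suc k) = begin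
      (3 + k) * (1 + (2 + k) * s) + 2                  ≡⟨ expand k s ⟩
      (3 + k) * ((2 + k) * s) + (5 + k)                ≤⟨ NP.+-monoʳ-≤ ((3 + k) * ((2 + k) * s)) (NP.+-monoʳ-≤ 5 (NP.m≤m+n k (1 + k))) ⟩
      (3 + k) * ((2 + k) * s) + (5 + (k + (1 + k)))    ≡⟨ factor k s ⟩
      (3 + k) * ((2 + k) * s + 2)                      ≤⟨ NP.*-monoʳ-≤ (3 + k) (eNumerator-bound k) ⟩
      (3 + k) * (6 * c)                                ≡⟨ swap-factors k c ⟩
      6 * ((3 + k) * c)                                ∎
    where
    open NP.≤-Reasoning
    s = eNumerator (suc k)
    c = numSists k
    expand : ∀ k s → (3 + k) * (1 + (2 + k) * s) + 2 ≡ (3 + k) * ((2 + k) * s) + (5 + k)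
    expand = solve-∀
    factor : ∀ k s → (3 + k) * ((2 + k) * s) + (5 + (k + (1 + k))) ≡ (3 + k) * ((2 + k) * s + 2)
    factor = solve-∀
    swap-factors : ∀ k c → (3 + k) * (6 * c) ≡ 6 * ((3 + k) * c)
    swap-factors = solve-∀

  -- strengthened invariant for the bound on Σ X(X-1) (here n = k + 3)
  sumFalling-invariant : ∀ k → (3 + k) * (2 + k) * sumFalling (suc k) + 4 * ((3 + k) * (3 + k)) ≤ 24 * numSists (suc k)
  sumFalling-invariant zero    = NP.≤-refl
  sumFalling-invariant (suc k) = begin
      (4 + k) * (3 + k) * ((2 + k) * d + 2 * (3 + k)) + 4 * ((4 + k) * (4 + k))
        ≡⟨ expand k d ⟩
      (4 + k) * Q + (4 + k) * R
        ≤⟨ NP.+-monoʳ-≤ ((4 + k) * Q) (NP.*-monoʳ-≤ (4 + k) (NP.m≤m+n R (2 * (1 + 4 * k + k * k)))) ⟩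
      (4 + k) * Q + (4 + k) * (R + 2 * (1 + 4 * k + k * k))
        ≡⟨ factor k Q ⟩
      (4 + k) * (Q + 4 * ((3 + k) * (3 + k)))
        ≤⟨ NP.*-monoʳ-≤ (4 + k) (sumFalling-invariant k) ⟩
      (4 + k) * (24 * c)
        ≡⟨ swap-factors k c ⟩
      24 * numSists (suc (suc k)) ∎
    where
    open NP.≤-Reasoning
    d = sumFalling (suc k)
    c = numSists (suc k)
    Q = (3 + k) * (2 + k) * d
    R = 2 * ((3 + k) * (3 + k)) + 4 * (4 + k)
    expand : ∀ k d → (4 + k) * (3 + k) * ((2 + k) * d + 2 * (3 + k)) + 4 * ((4 + k) * (4 + k))
                   ≡ (4 + k) * ((3 + k) * (2 + k) * d) + (4 + k) * (2 * ((3 + k) * (3 + k)) + 4 * (4 + k))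
    expand = solve-∀
    factor : ∀ k Q → (4 + k) * Q + (4 + k) * (2 * ((3 + k) * (3 + k)) + 4 * (4 + k) + 2 * (1 + 4 * k + k * k))
                   ≡ (4 + k) * (Q + 4 * ((3 + k) * (3 + k)))
    factor = solve-∀
    swap-factors : ∀ k c → (4 + k) * (24 * c) ≡ 24 * ((4 + k) * c)
    swap-factors = solve-∀

  sumFalling-bound : ∀ k → (2 + k) * (2 + k) * sumFalling k ≤ 48 * numSists k
  sumFalling-bound zero    = NP.+-monoʳ-≤ 8 z≤n
  sumFalling-bound (suc k) = begin
      (3 + k) * (3 + k) * d                                   ≤⟨ NP.m≤m+n _ ((3 + k) * (1 + k) * d) ⟩
      (3 + k) * (3 + k) * d + (3 + k) * (1 + k) * d           ≡⟨ factor k d ⟩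
      2 * ((3 + k) * (2 + k) * d)                             ≤⟨ NP.*-monoʳ-≤ 2 (NP.≤-trans (NP.m≤m+n _ (4 * ((3 + k) * (3 + k)))) (sumFalling-invariant k)) ⟩
      2 * (24 * numSists (suc k))                             ≡⟨ sym (NP.*-assoc 2 24 (numSists (suc k))) ⟩
      48 * numSists (suc k)                                   ∎
    where
    open NP.≤-Reasoning
    d = sumFalling (suc k)
    factor : ∀ k d → (3 + k) * (3 + k) * d + (3 + k) * (1 + k) * d ≡ 2 * ((3 + k) * (2 + k) * d)
    factor = solve-∀

module Estimates where
  open import Data.Nat as N using (ℕ; zero; suc; z≤n; s≤s; _!)
  import Data.Nat.Properties as NP
  open import Data.Nat.Tactic.RingSolver using (solve-∀)
  open import Data.Integer as ℤ using (+_)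
  import Data.Integer.Properties as ℤP
  open import Data.Rational as Q using (ℚ; _*_; _+_; _-_; ∣_∣; _≤_; 0ℚ)
  import Data.Rational.Properties as QP
  open import Data.Rational.Unnormalised as U using (mkℚᵘ; *≡*; *≤*)
  import Data.Rational.Unnormalised.Properties as UP
  open import Data.Rational.Solver using (module +-*-Solver)
  open +-*-Solver using (solve; _:+_; _:-_; _:*_; :-_; _:=_)
  open import Data.Product using (_×_; _,_)
  open import Data.Sum using (inj₁; inj₂)
  open import Relation.Binary.PropositionalEquality
  open Counting using (numSists; eNumerator; sumFalling; numSists-factorial; eNumerator-bound; sumFalling-bound; module Moments)

  -- Natural-number fractions p/q = fromℕ p * inv q.  Their arithmetic is
  -- transported from the unnormalised rationals, where it is cross-multiplication.

  frac : ℕ → ℕ → ℚ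
  frac p q = fromℕ p * inv q

  frac-toℚᵘ : ∀ p q' → Q.toℚᵘ (frac p (suc q')) U.≃ mkℚᵘ (+ p) q'
  frac-toℚᵘ p q' =
    UP.≃-trans (QP.toℚᵘ-homo-* (fromℕ p) (inv (suc q')))
      (UP.≃-trans (UP.*-cong (QP.toℚᵘ-fromℚᵘ (mkℚᵘ (+ p) 0)) (QP.toℚᵘ-fromℚᵘ (mkℚᵘ (+ 1) q')))
        (*≡* (trans (cong (ℤ._* (+ suc q')) (ℤP.*-identityʳ (+ p))) (cong (λ z → + p ℤ.* + suc z) (sym (NP.+-identityʳ q'))))))

  frac-fromℚᵘ : ∀ x p q' → Q.toℚᵘ x U.≃ mkℚᵘ (+ p) q' → x ≡ frac p (suc q')
  frac-fromℚᵘ x p q' e = QP.toℚᵘ-injective (UP.≃-trans e (UP.≃-sym (frac-toℚᵘ p q')))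

  frac-cong : ∀ p q r s → 1 N.≤ q → 1 N.≤ s → p N.* s ≡ r N.* q → frac p q ≡ frac r s
  frac-cong p (suc q') r (suc s') _ _ e = frac-fromℚᵘ (frac p (suc q')) r s'
    (UP.≃-trans (frac-toℚᵘ p q') (*≡* (trans (sym (ℤP.pos-* p (suc s'))) (trans (cong +_ e) (ℤP.pos-* r (suc q'))))))

  frac-≤ : ∀ p q r s → 1 N.≤ q → 1 N.≤ s → p N.* s N.≤ r N.* q → frac p q ≤ frac r s
  frac-≤ p (suc q') r (suc s') _ _ le = QP.toℚᵘ-cancel-≤
    (UP.≤-respʳ-≃ (UP.≃-sym (frac-toℚᵘ r s')) (UP.≤-respˡ-≃ (UP.≃-sym (frac-toℚᵘ p q'))
      (*≤* (subst₂ ℤ._≤_ (ℤP.pos-* p (suc s')) (ℤP.pos-* r (suc q')) (ℤ.+≤+ le)))))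

  frac-* : ∀ p q r s → 1 N.≤ q → 1 N.≤ s → frac p q * frac r s ≡ frac (p N.* r) (q N.* s)
  frac-* p (suc q') r (suc s') _ _ = frac-fromℚᵘ (frac p (suc q') * frac r (suc s')) (p N.* r) (s' N.+ q' N.* suc s')
    (UP.≃-trans (QP.toℚᵘ-homo-* (frac p (suc q')) (frac r (suc s')))
      (UP.≃-trans (UP.*-cong (frac-toℚᵘ p q') (frac-toℚᵘ r s')) (*≡* (cong (ℤ._* (+ suc (s' N.+ q' N.* suc s'))) (sym (ℤP.pos-* p r))))))

  frac-+ : ∀ p r q → 1 N.≤ q → frac p q + frac r q ≡ frac (p N.+ r) q
  frac-+ p r (suc q') _ =
    trans (frac-fromℚᵘ (frac p (suc q') + frac r (suc q')) (p N.* suc q' N.+ r N.* suc q') (q' N.+ q' N.* suc q')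
            (UP.≃-trans (QP.toℚᵘ-homo-+ (frac p (suc q')) (frac r (suc q')))
              (UP.≃-trans (UP.+-cong (frac-toℚᵘ p q') (frac-toℚᵘ r q')) (*≡* (cong (ℤ._* (+ suc (q' N.+ q' N.* suc q'))) numerator)))))
          (frac-cong (p N.* suc q' N.+ r N.* suc q') (suc q' N.* suc q') (p N.+ r) (suc q') (s≤s z≤n) (s≤s z≤n) cross)
    where
    numerator : + p ℤ.* + suc q' ℤ.+ + r ℤ.* + suc q' ≡ + (p N.* suc q' N.+ r N.* suc q')
    numerator = trans (cong₂ ℤ._+_ (sym (ℤP.pos-* p (suc q'))) (sym (ℤP.pos-* r (suc q')))) (sym (ℤP.pos-+ (p N.* suc q') _))
    cross : (p N.* suc q' N.+ r N.* suc q') N.* suc q' ≡ (p N.+ r) N.* (suc q' N.* suc q')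
    cross = trans (cong (N._* suc q') (sym (NP.*-distribʳ-+ (suc q') p r))) (NP.*-assoc (p N.+ r) (suc q') (suc q'))

  inv-frac : ∀ q → inv q ≡ frac 1 q
  inv-frac q = sym (QP.*-identityˡ (inv q))

  frac-nonneg : ∀ p q → 1 N.≤ q → 0ℚ ≤ frac p q
  frac-nonneg p q q≥1 = frac-≤ 0 1 p q (s≤s z≤n) q≥1 z≤n

  frac-scale : ∀ m p q → 1 N.≤ m → 1 N.≤ q → frac (m N.* p) (m N.* q) ≡ frac p q
  frac-scale m p q m≥1 q≥1 = frac-cong (m N.* p) (m N.* q) p q (NP.*-mono-≤ m≥1 q≥1) q≥1 (reorder m p q)
    where
    reorder : ∀ m p q → m N.* p N.* q ≡ p N.* (m N.* q)
    reorder = solve-∀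

  ≤-+-nonneg : ∀ x y → 0ℚ ≤ y → x ≤ x + y
  ≤-+-nonneg x y y≥0 = subst (_≤ x + y) (QP.+-identityʳ x) (QP.+-monoʳ-≤ x y≥0)

  ≤-nonneg-+ : ∀ x y → 0ℚ ≤ y → x ≤ y + x
  ≤-nonneg-+ x y y≥0 = subst (x ≤_) (QP.+-comm x y) (≤-+-nonneg x y y≥0)

  ∣-∣-swap : ∀ x y → ∣ x - y ∣ ≡ ∣ y - x ∣
  ∣-∣-swap x y = trans (cong ∣_∣ (negate x y)) (QP.∣-p∣≡∣p∣ (y - x))
    where
    negate : ∀ a b → a - b ≡ Q.- (b - a)
    negate = solve 2 (λ a b → a :- b := :- (b :- a)) refl

  square-mono : ∀ x y → 0ℚ ≤ x → x ≤ y → x * x ≤ y * y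
  square-mono x y x≥0 x≤y = QP.≤-trans (QP.*-monoˡ-≤-nonNeg x {{Q.nonNegative x≥0}} x≤y)
                                       (QP.*-monoʳ-≤-nonNeg y {{Q.nonNegative (QP.≤-trans x≥0 x≤y)}} x≤y)

  eApprox-frac : ∀ j → eApprox j ≡ frac (eNumerator j) (j !)
  eApprox-frac zero    = refl
  eApprox-frac (suc j) = begin
      eApprox j + inv (suc j !)
        ≡⟨ cong₂ _+_ (eApprox-frac j) (inv-frac (suc j !)) ⟩
      frac (eNumerator j) (j !) + frac 1 (suc j !)
        ≡⟨ cong (_+ frac 1 (suc j !)) (sym (frac-scale (suc j) (eNumerator j) (j !) (s≤s z≤n) (NP.1≤n! j))) ⟩
      frac (suc j N.* eNumerator j) (suc j !) + frac 1 (suc j !)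
        ≡⟨ frac-+ (suc j N.* eNumerator j) 1 (suc j !) (NP.1≤n! (suc j)) ⟩
      frac (suc j N.* eNumerator j N.+ 1) (suc j !)
        ≡⟨ cong (λ z → frac z (suc j !)) (NP.+-comm (suc j N.* eNumerator j) 1) ⟩
      frac (eNumerator (suc j)) (suc j !) ∎
    where open ≡-Reasoning

  -- 1/(q+1)! + 2/(q+2)! ≤ 2/(q+1)!: the tail bound 2/(m+1)! is self-propagating
  tail-step : ∀ q → inv (suc q !) + frac 2 (suc (suc q) !) ≤ frac 2 (suc q !)
  tail-step q = begin
      inv (suc q !) + frac 2 (suc (suc q) !)
        ≤⟨ QP.+-monoʳ-≤ (inv (suc q !)) (frac-≤ 2 (suc (suc q) !) 1 (suc q !) (NP.1≤n! (suc (suc q))) (NP.1≤n! (suc q)) cross) ⟩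
      inv (suc q !) + frac 1 (suc q !)  ≡⟨ cong (_+ frac 1 (suc q !)) (inv-frac (suc q !)) ⟩
      frac 1 (suc q !) + frac 1 (suc q !) ≡⟨ frac-+ 1 1 (suc q !) (NP.1≤n! (suc q)) ⟩
      frac 2 (suc q !) ∎
    where
    open QP.≤-Reasoning
    cross : 2 N.* suc q ! N.≤ 1 N.* (suc (suc q) !)
    cross = subst (2 N.* suc q ! N.≤_) (sym (NP.*-identityˡ (suc (suc q) !))) (NP.*-monoˡ-≤ (suc q !) {2} {suc (suc q)} (s≤s (s≤s z≤n)))

  eApprox-suc-diff : ∀ p m → eApprox (suc m) - eApprox p ≡ (eApprox m - eApprox p) + inv (suc m !)
  eApprox-suc-diff p m = solve 3 (λ a b c → (a :+ c) :- b := (a :- b) :+ c) refl (eApprox m) (eApprox p) (inv (suc m !))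

  eApprox-increasing : ∀ p r → 0ℚ ≤ eApprox (p N.+ r) - eApprox p
  eApprox-increasing p zero = subst (λ z → 0ℚ ≤ eApprox z - eApprox p) (sym (NP.+-identityʳ p))
                                (QP.≤-reflexive (sym (QP.+-inverseʳ (eApprox p))))
  eApprox-increasing p (suc r) = subst (λ z → 0ℚ ≤ eApprox z - eApprox p) (sym (NP.+-suc p r)) (begin
      0ℚ                                   ≡⟨ sym (QP.+-identityʳ 0ℚ) ⟩
      0ℚ + 0ℚ                              ≤⟨ QP.+-mono-≤ (eApprox-increasing p r) (frac-nonneg 1 (suc m !) (NP.1≤n! (suc m))) ⟩
      (eApprox m - eApprox p) + frac 1 (suc m !) ≡⟨ cong (λ z → (eApprox m - eApprox p) + z) (sym (inv-frac (suc m !))) ⟩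
      (eApprox m - eApprox p) + inv (suc m !)    ≡⟨ sym (eApprox-suc-diff p m) ⟩
      eApprox (suc m) - eApprox p ∎)
    where
    open QP.≤-Reasoning
    m = p N.+ r

  eApprox-tail : ∀ p r → eApprox (p N.+ r) - eApprox p + frac 2 (suc (p N.+ r) !) ≤ frac 2 (suc p !)
  eApprox-tail p zero = subst (λ z → eApprox z - eApprox p + frac 2 (suc z !) ≤ frac 2 (suc p !)) (sym (NP.+-identityʳ p)) (begin
      eApprox p - eApprox p + frac 2 (suc p !) ≡⟨ cong (_+ frac 2 (suc p !)) (QP.+-inverseʳ (eApprox p)) ⟩
      0ℚ + frac 2 (suc p !)                    ≡⟨ QP.+-identityˡ _ ⟩
      frac 2 (suc p !)                         ∎)
    where open QP.≤-Reasoning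
  eApprox-tail p (suc r) = subst (λ z → eApprox z - eApprox p + frac 2 (suc z !) ≤ frac 2 (suc p !)) (sym (NP.+-suc p r)) (begin
      eApprox (suc m) - eApprox p + frac 2 (suc (suc m) !) ≡⟨ cong (_+ frac 2 (suc (suc m) !)) (eApprox-suc-diff p m) ⟩
      (D + inv (suc m !)) + frac 2 (suc (suc m) !)          ≡⟨ QP.+-assoc D _ _ ⟩
      D + (inv (suc m !) + frac 2 (suc (suc m) !))          ≤⟨ QP.+-monoʳ-≤ D (tail-step m) ⟩
      D + frac 2 (suc m !)                                  ≤⟨ eApprox-tail p r ⟩
      frac 2 (suc p !)                                      ∎)
    where
    open QP.≤-Reasoning
    m = p N.+ r
    D = eApprox m - eApprox p

  eApprox-tail-abs : ∀ p r → ∣ eApprox (p N.+ r) - eApprox p ∣ ≤ frac 2 (suc p !)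
  eApprox-tail-abs p r = begin
      ∣ eApprox (p N.+ r) - eApprox p ∣ ≡⟨ QP.0≤p⇒∣p∣≡p (eApprox-increasing p r) ⟩
      eApprox (p N.+ r) - eApprox p     ≤⟨ ≤-+-nonneg _ _ (frac-nonneg 2 _ (NP.1≤n! (suc (p N.+ r)))) ⟩
      eApprox (p N.+ r) - eApprox p + frac 2 (suc (p N.+ r) !) ≤⟨ eApprox-tail p r ⟩
      frac 2 (suc p !) ∎
    where open QP.≤-Reasoning

  eApprox-distance : ∀ p q → ∣ eApprox p - eApprox q ∣ ≤ frac 2 (suc p !) + frac 2 (suc q !)
  eApprox-distance p q with NP.≤-total p q
  ... | inj₁ p≤q with NP.m≤n⇒∃[o]m+o≡n p≤q
  ...   | r , refl = begin
      ∣ eApprox p - eApprox (p N.+ r) ∣ ≡⟨ ∣-∣-swap (eApprox p) _ ⟩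
      ∣ eApprox (p N.+ r) - eApprox p ∣ ≤⟨ eApprox-tail-abs p r ⟩
      frac 2 (suc p !)                  ≤⟨ ≤-+-nonneg _ _ (frac-nonneg 2 _ (NP.1≤n! (suc (p N.+ r)))) ⟩
      frac 2 (suc p !) + frac 2 (suc (p N.+ r) !) ∎
    where open QP.≤-Reasoning
  eApprox-distance p q | inj₂ q≤p with NP.m≤n⇒∃[o]m+o≡n q≤p
  ...   | r , refl = QP.≤-trans (eApprox-tail-abs q r) (≤-nonneg-+ _ _ (frac-nonneg 2 _ (NP.1≤n! (suc (q N.+ r)))))

  -- The estimates for n = k + 2, in terms of the closed forms:
  -- E = E(X) = s/c and D = E(X(X-1)) = d/c.

  module Bounds (k : ℕ) where
    n = suc (suc k)
    c = numSists k
    s = eNumerator (suc k)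
    d = sumFalling k
    a = frac 2 n
    E = frac s c
    D = frac d c

    c≥1 : 1 N.≤ c
    c≥1 = positive k
      where
      positive : ∀ k → 1 N.≤ numSists k
      positive zero    = s≤s z≤n
      positive (suc k) = NP.*-mono-≤ {1} {3 N.+ k} (s≤s z≤n) (positive k)

    n≥1 : 1 N.≤ n
    n≥1 = s≤s z≤n

    n≤n! : n N.≤ n !
    n≤n! = subst (N._≤ n !) (NP.*-identityʳ n) (NP.*-monoʳ-≤ n (NP.1≤n! (suc k)))

    n²≥1 : 1 N.≤ n N.* n
    n²≥1 = NP.*-mono-≤ n≥1 n≥1

    a≥0 : 0ℚ ≤ a
    a≥0 = frac-nonneg 2 n n≥1

    -- E(X) = (2/n)·e_{n-1} exactly, since c = n!/2 and s = (n-1)!·e_{n-1}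
    E-exact : E ≡ a * eApprox (suc k)
    E-exact = begin
        frac s c                         ≡⟨ sym (frac-scale 2 s c (s≤s z≤n) c≥1) ⟩
        frac (2 N.* s) (2 N.* c)         ≡⟨ cong (frac (2 N.* s)) (numSists-factorial k) ⟩
        frac (2 N.* s) (n N.* suc k !)   ≡⟨ sym (frac-* 2 n s (suc k !) n≥1 (NP.1≤n! (suc k))) ⟩
        frac 2 n * frac s (suc k !)      ≡⟨ cong (a *_) (sym (eApprox-frac (suc k))) ⟩
        a * eApprox (suc k)              ∎
      where open ≡-Reasoning

    E-close : ∀ m → ∣ E - a * eApprox m ∣ ≤ frac 4 (n N.* n !) + a * frac 2 (suc m !)
    E-close m = begin
        ∣ E - a * eApprox m ∣                      ≡⟨ cong (λ z → ∣ z - a * eApprox m ∣) E-exact ⟩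
        ∣ a * eApprox (suc k) - a * eApprox m ∣    ≡⟨ cong ∣_∣ (factor-out a (eApprox (suc k)) (eApprox m)) ⟩
        ∣ a * (eApprox (suc k) - eApprox m) ∣      ≡⟨ QP.∣p*q∣≡∣p∣*∣q∣ a _ ⟩
        ∣ a ∣ * ∣ eApprox (suc k) - eApprox m ∣    ≡⟨ cong (_* ∣ eApprox (suc k) - eApprox m ∣) (QP.0≤p⇒∣p∣≡p a≥0) ⟩
        a * ∣ eApprox (suc k) - eApprox m ∣        ≤⟨ QP.*-monoˡ-≤-nonNeg a {{Q.nonNegative a≥0}} (eApprox-distance (suc k) m) ⟩
        a * (frac 2 (n !) + frac 2 (suc m !))      ≡⟨ QP.*-distribˡ-+ a _ _ ⟩
        a * frac 2 (n !) + a * frac 2 (suc m !)    ≡⟨ cong (_+ a * frac 2 (suc m !)) (frac-* 2 n 2 (n !) n≥1 (NP.1≤n! n)) ⟩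
        frac 4 (n N.* n !) + a * frac 2 (suc m !)  ∎
      where
      open QP.≤-Reasoning
      factor-out : ∀ a e f → a * e - a * f ≡ a * (e - f)
      factor-out = solve 3 (λ a e f → a :* e :- a :* f := a :* (e :- f)) refl

    expect-close : CloseToMultipleOfE E a (fromℕ 88 * inv (n !))
    expect-close m = QP.≤-trans (E-close m)
      (QP.+-monoˡ-≤ (a * frac 2 (suc m !)) (frac-≤ 4 (n N.* n !) 88 (n !) (NP.*-mono-≤ n≥1 (NP.1≤n! n)) (NP.1≤n! n) cross))
      where
      cross : 4 N.* n ! N.≤ 88 N.* (n N.* n !)
      cross = NP.*-mono-≤ (NP.m≤m+n 4 84) (NP.m≤n*m (n !) n)

    D-bound : D ≤ frac 48 (n N.* n)
    D-bound = frac-≤ d c 48 (n N.* n) c≥1 n²≥1 (subst (N._≤ 48 N.* c) (NP.*-comm (n N.* n) d) (sumFalling-bound k))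

    E-bound : E ≤ frac 6 n
    E-bound = frac-≤ s c 6 n c≥1 n≥1 (subst (N._≤ 6 N.* c) (NP.*-comm n s) (NP.≤-trans (NP.m≤m+n (n N.* s) 2) (eNumerator-bound k)))

    E²-bound : E * E ≤ frac 36 (n N.* n)
    E²-bound = QP.≤-trans (square-mono E (frac 6 n) (frac-nonneg s c c≥1) E-bound) (QP.≤-reflexive (frac-* 6 n 6 n n≥1 n≥1))

    -- V(X) = E(X) + (E(X(X-1)) - E(X)²), the bracket being O(1/n²)
    variance-close : CloseToMultipleOfE (frac (d N.+ s) c - E * E) a (fromℕ 88 * inv (n N.* n))
    variance-close m = begin
        ∣ frac (d N.+ s) c - E * E - A ∣             ≡⟨ cong (λ z → ∣ z - E * E - A ∣) (sym (frac-+ d s c c≥1)) ⟩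
        ∣ D + E - E * E - A ∣                        ≡⟨ cong ∣_∣ (regroup D E A) ⟩
        ∣ (E - A) + (D - E * E) ∣                    ≤⟨ QP.∣p+q∣≤∣p∣+∣q∣ (E - A) _ ⟩
        ∣ E - A ∣ + ∣ D - E * E ∣                    ≤⟨ QP.+-mono-≤ (E-close m) (QP.∣p-q∣≤∣p∣+∣q∣ D (E * E)) ⟩
        (frac 4 (n N.* n !) + Y) + (∣ D ∣ + ∣ E * E ∣)
          ≡⟨ cong₂ (λ u v → (frac 4 (n N.* n !) + Y) + (u + v)) (QP.0≤p⇒∣p∣≡p D≥0) (QP.0≤p⇒∣p∣≡p E²≥0) ⟩
        (frac 4 (n N.* n !) + Y) + (D + E * E)       ≡⟨ move-Y (frac 4 (n N.* n !)) Y D (E * E) ⟩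
        (frac 4 (n N.* n !) + D + E * E) + Y         ≤⟨ QP.+-monoˡ-≤ Y (QP.+-mono-≤ (QP.+-mono-≤ small D-bound) E²-bound) ⟩
        (frac 4 (n N.* n) + frac 48 (n N.* n) + frac 36 (n N.* n)) + Y
          ≡⟨ cong (_+ Y) (trans (cong (_+ frac 36 (n N.* n)) (frac-+ 4 48 (n N.* n) n²≥1)) (frac-+ 52 36 (n N.* n) n²≥1)) ⟩
        frac 88 (n N.* n) + Y                        ∎
      where
      open QP.≤-Reasoning
      A = a * eApprox m
      Y = a * frac 2 (suc m !)
      D≥0 : 0ℚ ≤ D
      D≥0 = frac-nonneg d c c≥1
      E²≥0 : 0ℚ ≤ E * E
      E²≥0 = QP.≤-trans (QP.≤-reflexive (sym (QP.*-zeroˡ E))) (QP.*-monoʳ-≤-nonNeg E {{Q.nonNegative (frac-nonneg s c c≥1)}} (frac-nonneg s c c≥1))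
      small : frac 4 (n N.* n !) ≤ frac 4 (n N.* n)
      small = frac-≤ 4 (n N.* n !) 4 (n N.* n) (NP.*-mono-≤ n≥1 (NP.1≤n! n)) n²≥1 (NP.*-monoʳ-≤ 4 (NP.*-monoʳ-≤ n n≤n!))
      regroup : ∀ D E A → D + E - E * E - A ≡ (E - A) + (D - E * E)
      regroup = solve 3 (λ D E A → D :+ E :- E :* E :- A := (E :- A) :+ (D :- E :* E)) refl
      move-Y : ∀ x y u v → (x + y) + (u + v) ≡ (x + u + v) + y
      move-Y = solve 4 (λ x y u v → (x :+ y) :+ (u :+ v) := (x :+ u :+ v) :+ y) refl

  moments-close : ∀ k L → Enumerates (2 N.+ k) L → let n = 2 N.+ k in
    CloseToMultipleOfE (expect L) (fromℕ 2 * inv n) (fromℕ 88 * inv (n !))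
    × CloseToMultipleOfE (variance L) (fromℕ 2 * inv n) (fromℕ 88 * inv (n N.* n))
  moments-close k L enum =
    subst (λ x → CloseToMultipleOfE x a (fromℕ 88 * inv (n !))) (sym expect-L) expect-close ,
    subst (λ x → CloseToMultipleOfE x a (fromℕ 88 * inv (n N.* n))) (sym variance-L) variance-close
    where
    open Moments k L enum
    open Bounds k
    expect-L : expect L ≡ E
    expect-L = cong₂ (λ x y → fromℕ x * inv y) sum-X length-L
    variance-L : variance L ≡ frac (d N.+ s) c - E * E
    variance-L = cong₂ (λ x y → x - y * y) (cong₂ (λ x y → fromℕ x * inv y) sum-X² length-L) expect-L

open import Data.Nat using (ℕ; zero; suc; _≤_; s≤s; _!) renaming (_*_ to _*ℕ_)
open import Data.Rational using (ℚ; _*_)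
open import Data.List using (List)
open import Data.Product using (Σ; _×_; _,_)

theorem3 : Σ ℚ (λ C → Σ ℕ (λ N → (n : ℕ) → N ≤ n → (L : List Tree) → Enumerates n L →
    CloseToMultipleOfE (expect L) (fromℕ 2 * inv n) (C * inv (n !))
    × CloseToMultipleOfE (variance L) (fromℕ 2 * inv n) (C * inv (n *ℕ n))))
theorem3 = fromℕ 88 , 2 , bound
  where
  bound : (n : ℕ) → 2 ≤ n → (L : List Tree) → Enumerates n L →
    CloseToMultipleOfE (expect L) (fromℕ 2 * inv n) (fromℕ 88 * inv (n !))
    × CloseToMultipleOfE (variance L) (fromℕ 2 * inv n) (fromℕ 88 * inv (n *ℕ n))
  bound (suc zero) (s≤s ())
  bound (suc (suc k)) _ = Estimates.moments-close k
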